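{- Let $\mathcal L$ be a recursively enumerable language over a finite alphabet. Then there exist a coverability language $\mathcal L'$ of some labelled marked RPN (with a finite set of final states), a regular language $\mathcal R$ and a homomorphism $h$ such that $\mathcal L=h(\mathcal L'\cap\mathcal R)$.
   Context: A Recursive Petri Net (RPN) is a tuple $\mathcal N=\langle P,T,W^+,W^-,\Omega\rangle$ where $P$ is a finite set of places, $T=T_{el}\uplus T_{ab}\uplus T_{\tau}$ is a finite set of transitions disjoint from $P$ (elementary, abstract and cut transitions), $W^-\in\mathbb N^{P\times T}$, $W^+\in\mathbb N^{P\times(T_{el}\uplus T_{ab})}$, and $\Omega:T_{ab}\to\mathbb N^P$. Write $W^{\pm}(t)\in\mathbb N^P$ for the column of $t$; markings are compared componentwise. A (concrete) state is either the empty tree $\emptyset$ or a finite rooted tree whose vertices (threads) are taken from a fixed countably infinite set $\mathcal V$, each vertex $v$ labelled by a marking $M_s(v)\in\mathbb N^P$ and each edge labelled by a vector in $\{W^+(t):t\in T_{ab}\}$. Firing rule: a thread $v$ of a state $s\neq\emptyset$ can fire $t$ if $W^-(t)\le M_s(v)$, giving $s\xrightarrow{(v,t)}s'$ where: if $t\in T_{el}$, the marking of $v$ becomes $M_s(v)-W^-(t)+W^+(t)$; if $t\in T_{ab}$, the marking of $v$ becomes $M_s(v)-W^-(t)$ and a new child $w$ of $v$ (a vertex never used before) is created with marking $\Omega(t)$ and edge $v\to w$ labelled $W^+(t)$; if $t\in T_\tau$, the subtree rooted at $v$ is deleted, and if $v$ is the root the result is $\emptyset$, otherwise the marking of the parent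 $u$ of $v$ is increased by the label of the edge $u\to v$. Quasi-order on states: $\emptyset\preceq s$ for every $s$; for $s\neq\emptyset$, $s\preceq s'$ iff there is an injective map $f$ from the vertices of $s$ to those of $s'$ with $M_s(v)\le M_{s'}(f(v))$ for all $v$ and, for every edge $v\to w$ of $s$ labelled $m$, an edge $f(v)\to f(w)$ of $s'$ labelled $m'\ge m$. A labelled RPN has a labelling $\lambda:T\to\Sigma\cup\{\varepsilon\}$ ($\Sigma$ finite), extended morphically to sequences; its coverability language for initial state $s_0$ and finite set of states $S_f$ is $\mathcal L_C(\mathcal N,s_0,S_f)=\{\lambda(\sigma)\mid s_0\xrightarrow{\sigma}s,\ s_f\preceq s\text{ for some }s_f\in S_f\}$. -}

module Defs where

open import Data.Nat using (ℕ; _≤_; _+_; _∸_)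
open import Data.Fin using (Fin)
open import Data.List using (List; []; _∷_; _++_; map; concatMap)
open import Data.List.Membership.Propositional using (_∈_)
open import Data.List.Relation.Unary.Any using (Any)
open import Data.Maybe using (Maybe; just; nothing)
open import Data.Bool using (Bool; true)
open import Data.Sum using (_⊎_; inj₁; inj₂)
open import Data.Product using (Σ; _×_; _,_; ∃)
open import Relation.Binary.PropositionalEquality using (_≡_)

Word : ℕ → Set
Word k = List (Fin k)

Lang : ℕ → Set₁
Lang k = Word k → Set

-- Recursively enumerable languages: languages generated by unrestricted
-- (type-0) grammars.

Sym : ℕ → ℕ → Set
Sym k m = Fin k ⊎ Fin m   -- terminals ⊎ nonterminals

IsNonterminal : ∀ {k m} → Sym k m → Set
IsNonterminal {k} {m} x = Σ (Fin m) λ A → x ≡ inj₂ A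

record Production (k m : ℕ) : Set where
  field
    lhs : List (Sym k m)
    rhs : List (Sym k m)
    lhs-has-nonterminal : Any IsNonterminal lhs

record Grammar (k : ℕ) : Set where
  field
    m     : ℕ                    -- number of nonterminals
    start : Fin m
    prods : List (Production k m)

module _ {k : ℕ} (G : Grammar k) where
  open Grammar G

  data DStep : List (Sym k m) → List (Sym k m) → Set where
    dstep : ∀ (u v : List (Sym k m)) (p : Production k m) → p ∈ prods →
            DStep (u ++ Production.lhs p ++ v) (u ++ Production.rhs p ++ v)

  data Derives : List (Sym k m) → List (Sym k m) → Set where
    d-refl : ∀ {x} → Derives x x
    d-step : ∀ {x y z} → DStep x y → Derives y z → Derives x z

  GLang : Lang k
  GLang w = Derives (inj₂ start ∷ []) (map inj₁ w)

IsRE : ∀ {k} → Lang k → Set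
IsRE {k} L = Σ (Grammar k) λ G → ∀ w → (L w → GLang G w) × (GLang G w → L w)

record DFA (k : ℕ) : Set where
  field
    n      : ℕ
    q₀     : Fin n
    δ      : Fin n → Fin k → Fin n
    accept : Fin n → Bool

  run : Fin n → Word k → Fin n
  run q []       = q
  run q (a ∷ w)  = run (δ q a) w

  DLang : Lang k
  DLang w = accept (run q₀ w) ≡ true

IsRegular : ∀ {k} → Lang k → Set
IsRegular {k} R = Σ (DFA k) λ A → ∀ w → (R w → DFA.DLang A w) × (DFA.DLang A w → R w)

hom : ∀ {k k'} → (Fin k' → Word k) → Word k' → Word k
hom h = concatMap h

Marking : ℕ → Set
Marking p = Fin p → ℕ

_≤M_ : ∀ {p} → Marking p → Marking p → Set
M ≤M M' = ∀ i → M i ≤ M' i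

_+M_ : ∀ {p} → Marking p → Marking p → Marking p
(M +M M') i = M i + M' i

_∸M_ : ∀ {p} → Marking p → Marking p → Marking p
(M ∸M M') i = M i ∸ M' i

record LRPN (k : ℕ) : Set where
  field
    p    : ℕ                         -- places
    nel  : ℕ                         -- elementary transitions
    nab  : ℕ                         -- abstract transitions
    ncut : ℕ                         -- cut transitions
    W⁻el  : Fin nel → Marking p
    W⁻ab  : Fin nab → Marking p
    W⁻cut : Fin ncut → Marking p
    W⁺el  : Fin nel → Marking p
    W⁺ab  : Fin nab → Marking p
    Ω     : Fin nab → Marking p
    -- labelling λ : T → Σ ∪ {ε}  (nothing = ε)
    labEl  : Fin nel → Maybe (Fin k)
    labAb  : Fin nab → Maybe (Fin k)
    labCut : Fin ncut → Maybe (Fin k)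

-- Concrete non-empty states up to renaming of threads: finite rooted trees,
-- vertices labelled by markings; an edge is labelled W⁺(t) for an abstract
-- transition t, recorded here by t itself.
data Tree (p nab : ℕ) : Set where
  node : Marking p → List (Fin nab × Tree p nab) → Tree p nab

-- A state: nothing = the empty tree ∅
State : ∀ {k} → LRPN k → Set
State N = Maybe (Tree (LRPN.p N) (LRPN.nab N))

module _ {k : ℕ} (N : LRPN k) where
  open LRPN N

  T : Set
  T = Fin nel ⊎ Fin nab ⊎ Fin ncut

  TTree : Set
  TTree = Tree p nab

  Child : Set
  Child = Fin nab × TTree

  λ* : List T → Word k
  λ* [] = []
  λ* (inj₁ t ∷ σ) with labEl t
  ... | just a  = a ∷ λ* σ
  ... | nothing = λ* σ
  λ* (inj₂ (inj₁ t) ∷ σ) with labAb t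
  ... | just a  = a ∷ λ* σ
  ... | nothing = λ* σ
  λ* (inj₂ (inj₂ t) ∷ σ) with labCut t
  ... | just a  = a ∷ λ* σ
  ... | nothing = λ* σ

  -- Firing a transition at some thread of a (non-empty) tree; the result is
  -- nothing when the root itself is cut.
  data Fire : TTree → T → Maybe TTree → Set where
    fire-el  : ∀ {M cs} (t : Fin nel) → W⁻el t ≤M M →
               Fire (node M cs) (inj₁ t) (just (node ((M ∸M W⁻el t) +M W⁺el t) cs))
    fire-ab  : ∀ {M cs} (t : Fin nab) → W⁻ab t ≤M M →
               Fire (node M cs) (inj₂ (inj₁ t))
                    (just (node (M ∸M W⁻ab t) ((t , node (Ω t) []) ∷ cs)))
    fire-cut : ∀ {M cs} (t : Fin ncut) → W⁻cut t ≤M M →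
               Fire (node M cs) (inj₂ (inj₂ t)) nothing
    fire-in  : ∀ {M} (pre post : List Child) (a : Fin nab) {c c' : TTree} {t : T} →
               Fire c t (just c') →
               Fire (node M (pre ++ (a , c) ∷ post)) t
                    (just (node M (pre ++ (a , c') ∷ post)))
    fire-in-cut : ∀ {M} (pre post : List Child) (a : Fin nab) {c : TTree} {t : T} →
               Fire c t nothing →
               Fire (node M (pre ++ (a , c) ∷ post)) t
                    (just (node (M +M W⁺ab a) (pre ++ post)))

  data Step : State N → T → State N → Set where
    step : ∀ {s t s'} → Fire s t s' → Step (just s) t s'

  data Steps : State N → List T → State N → Set where
    done : ∀ {s} → Steps s [] s
    more : ∀ {s t s' σ s''} → Step s t s' → Steps s' σ s'' → Steps s (t ∷ σ) s''

  -- Root-to-root embedding: injective map preserving the tree structure,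
  -- markings ≤ and edge labels ≤.
  data Emb : TTree → TTree → Set
  data EmbChildren : List Child → List Child → Set

  data Emb where
    emb : ∀ {M M' cs cs'} → M ≤M M' → EmbChildren cs cs' → Emb (node M cs) (node M' cs')

  data EmbChildren where
    ec-nil  : ∀ {cs'} → EmbChildren [] cs'
    ec-cons : ∀ {a c cs a' c'} (pre post : List Child) →
              W⁺ab a ≤M W⁺ab a' → Emb c c' → EmbChildren cs (pre ++ post) →
              EmbChildren ((a , c) ∷ cs) (pre ++ (a' , c') ∷ post)

  data SubEmb : TTree → TTree → Set where
    here  : ∀ {s s'} → Emb s s' → SubEmb s s'
    there : ∀ {s M cs a c} → (a , c) ∈ cs → SubEmb s c → SubEmb s (node M cs)

  _≼_ : State N → State N → Set
  nothing ≼ _       = ⊤'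
    where open import Data.Unit using () renaming (⊤ to ⊤')
  just s  ≼ nothing = ⊥'
    where open import Data.Empty using () renaming (⊥ to ⊥')
  just s  ≼ just s' = SubEmb s s'

  CovLang : State N → List (State N) → Lang k
  CovLang s₀ Sf w = Σ (List T) λ σ → Σ (State N) λ s →
    Steps s₀ σ s × Σ (State N) (λ sf → sf ∈ Sf × sf ≼ s) × λ* σ ≡ w

-- A type-0 grammar is run by a machine with two stacks A and B, the sentential
-- form being reverse A ++ B.  The machine moves symbols across the boundary and
-- rewrites a left-hand side on top of B into the right-hand side; once the form
-- consists of terminals it closes A, pops and emits the terminals, and closes B.
-- The net keeps each stack as a chain of threads below the root: pushing is an
-- abstract transition, popping a cut, and closing a stack returns a token to the
-- root, so that covering the final state means that both stacks were closed.
-- Every transition is labelled by its instruction; the regular language is the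
-- local language of well-sequenced instruction words, and the homomorphism keeps
-- the emitted letters only.

module Submission where

open import Defs
open import Data.Bool using (Bool; true; false; if_then_else_)
open import Data.Empty using (⊥; ⊥-elim)
open import Data.Fin using (Fin; zero; suc; _↑ʳ_; inject₁; inject≤; fromℕ; toℕ)
open import Data.Fin.Properties using (_≟_; ↑ʳ-injective; +↔⊎; *↔×; toℕ-inject≤; toℕ-inject₁; toℕ-fromℕ)
open import Data.List using (List; []; _∷_; _++_; _∷ʳ_; map; reverse; fromMaybe; tabulate; head; drop; take; lookup; length; concatMap)
open import Data.List.Membership.Propositional using (_∈_)
open import Data.List.Membership.Propositional.Properties using (∈-++⁻; ∈-lookup)
open import Data.List.Properties using (∷-injective; ∷-injectiveʳ; reverse-++; reverse-selfInverse; reverse-involutive; unfold-reverse; map-∘; map-cong; map-id; map-++; ++-assoc; ++-identityʳ; take-all; map-tabulate; tabulate-cong; tabulate-lookup; concatMap-++; concatMap-map)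
open import Data.List.Relation.Unary.Any using (here; there; index)
open import Data.List.Relation.Unary.Any.Properties using (lookup-index)
open import Data.Maybe using (Maybe; just; nothing)
import Data.Maybe
open import Data.Nat using (ℕ; zero; suc; _+_; _*_; _∸_; _≤_; z≤n; s≤s)
open import Data.Nat.ListAction using (sum)
open import Data.Nat.Properties using (m+n∸n≡m; m≤m+n; m≤n+m; ≤-trans; ≤-reflexive; +-comm; +-identityʳ)
import Data.Nat.Properties as ℕ
open import Data.Product using (Σ; _×_; _,_; proj₁; proj₂)
open import Data.Product.Function.NonDependent.Propositional using (_×-↔_)
open import Data.Sum using (_⊎_; inj₁; inj₂)
open import Data.Sum.Function.Propositional using (_⊎-↔_)
open import Data.Sum.Properties using (≡-dec)
open import Data.Unit using (⊤; tt)
open import Function using (_∘_; id)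
open import Function.Bundles using (_⇔_; mk⇔; _↔_; mk↔ₛ′; Inverse; Injection; Equivalence)
open import Function.Properties.Inverse using (↔-refl; ↔-sym; ↔-trans; ↔⇒↣)
open import Relation.Binary using (DecidableEquality) renaming (Decidable to Decidable₂)
open import Relation.Binary.PropositionalEquality
open import Relation.Nullary using (¬_; does; yes; no; Dec; map′)
open import Relation.Nullary.Decidable using (dec-true; dec-false; _⊎-dec_; _×-dec_)
open import Relation.Unary using (Decidable)

module _ {A : Set} where

  ++-∷-≢-[] : ∀ (pre : List A) {x post} → pre ++ x ∷ post ≢ []
  ++-∷-≢-[] []      ()
  ++-∷-≢-[] (_ ∷ _) ()

  ∷-position-in-[_] : ∀ {pre post : List A} {x} y → pre ++ x ∷ post ≡ y ∷ [] →
                      pre ≡ [] × x ≡ y × post ≡ []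
  ∷-position-in-[_] {[]}          y refl = refl , refl , refl
  ∷-position-in-[_] {_ ∷ []}      y ()
  ∷-position-in-[_] {_ ∷ _ ∷ _}   y ()

  ∷-position-in-fromMaybe-++ : ∀ pre {x : A} post l r → pre ++ x ∷ post ≡ fromMaybe l ++ fromMaybe r →
    (l ≡ just x × pre ≡ [] × post ≡ fromMaybe r) ⊎ (r ≡ just x × pre ≡ fromMaybe l × post ≡ [])
  ∷-position-in-fromMaybe-++ []      post (just y) r        refl = inj₁ (refl , refl , refl)
  ∷-position-in-fromMaybe-++ (_ ∷ pre) post (just y) (just z) eq
    with refl , e ← ∷-injective eq with refl , refl , refl ← ∷-position-in-[ z ] e =
    inj₂ (refl , refl , refl)
  ∷-position-in-fromMaybe-++ (_ ∷ pre) post (just y) nothing eq =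
    ⊥-elim (++-∷-≢-[] pre (∷-injectiveʳ eq))
  ∷-position-in-fromMaybe-++ pre     post nothing (just z)  eq with refl , refl , refl ← ∷-position-in-[ z ] eq =
    inj₂ (refl , refl , refl)

  reverse-∷-++ : ∀ (y : A) xs ys → reverse (y ∷ xs) ++ ys ≡ reverse xs ++ y ∷ ys
  reverse-∷-++ y xs ys = trans (cong (_++ ys) (unfold-reverse y xs)) (++-assoc (reverse xs) (y ∷ []) ys)

  head-drop-lookup : ∀ (xs : List A) i → head (drop (toℕ i) xs) ≡ just (lookup xs i)
  head-drop-lookup (_ ∷ _)  zero    = refl
  head-drop-lookup (_ ∷ xs) (suc i) = head-drop-lookup xs i

  take-suc-head : ∀ (xs : List A) n {x} → head (drop n xs) ≡ just x → take (suc n) xs ≡ take n xs ∷ʳ x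
  take-suc-head (_ ∷ _)  zero    refl = refl
  take-suc-head (y ∷ xs) (suc n) eq   = cong (y ∷_) (take-suc-head xs n eq)

  lookup-≤-sum : ∀ (f : A → ℕ) xs i → f (lookup xs i) ≤ sum (map f xs)
  lookup-≤-sum f (x ∷ xs) zero    = m≤m+n (f x) _
  lookup-≤-sum f (x ∷ xs) (suc i) = ≤-trans (lookup-≤-sum f xs i) (m≤n+m _ (f x))

  reverse-≡-∷ʳ : ∀ {xs bs : List A} {y} → reverse xs ≡ bs ∷ʳ y → xs ≡ y ∷ reverse bs
  reverse-≡-∷ʳ {bs = bs} {y} eq = trans (sym (reverse-selfInverse eq)) (reverse-++ bs (y ∷ []))

Finite : Set → Set
Finite A = Σ ℕ λ n → A ↔ Fin n

finite-⊎ : ∀ {A B} → Finite A → Finite B → Finite (A ⊎ B)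
finite-⊎ (a , A↔) (b , B↔) = a + b , ↔-trans (A↔ ⊎-↔ B↔) (↔-sym +↔⊎)

finite-× : ∀ {A B} → Finite A → Finite B → Finite (A × B)
finite-× (a , A↔) (b , B↔) = a * b , ↔-trans (A↔ ×-↔ B↔) (↔-sym *↔×)

finite-Fin : ∀ n → Finite (Fin n)
finite-Fin n = n , ↔-refl

finite-↔ : ∀ {A B} → A ↔ B → Finite B → Finite A
finite-↔ A↔B (n , B↔) = n , ↔-trans A↔B B↔

module LocalLanguage {A : Set} (Initial : A → Set) (_⇢_ : A → A → Set) (Final : A → Set) where

  Linked : A → List A → Set
  Linked a []      = Final a
  Linked a (b ∷ w) = a ⇢ b × Linked b w

  Local : List A → Set
  Local []      = ⊥
  Local (a ∷ w) = Initial a × Linked a w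

  linked-local : ∀ {a w} → (∀ {b} → Initial b → a ⇢ b) → Local w → Linked a w
  linked-local {w = _ ∷ _} link (init , l) = link init , l

  tabulate-linked : ∀ {n} (f : Fin (suc n) → A) {v} → (∀ i → f (inject₁ i) ⇢ f (suc i)) →
                    (∀ {b} → Initial b → f (fromℕ n) ⇢ b) → Local v →
                    Linked (f zero) (tabulate (f ∘ suc) ++ v)
  tabulate-linked {zero}  f {_ ∷ _} links last (init , l) = last init , l
  tabulate-linked {suc n} f links last loc = links zero , tabulate-linked (f ∘ suc) (links ∘ suc) last loc

  module _ {n : ℕ} (decode : Fin n → A)
           (initial? : Decidable Initial) (follows? : Decidable₂ _⇢_) (final? : Decidable Final) where

    -- States: 0 before the first letter, 1 a rejecting sink, 2 + a after the letter a.
    dead : Fin (2 + n)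
    dead = suc zero

    after : Fin n → Fin (2 + n)
    after a = suc (suc a)

    localDFA : DFA n
    localDFA = record { n = 2 + n ; q₀ = zero ; δ = δ ; accept = accept }
      where
      δ : Fin (2 + n) → Fin n → Fin (2 + n)
      δ zero          b = if does (initial? (decode b)) then after b else dead
      δ (suc zero)    b = dead
      δ (suc (suc a)) b = if does (follows? (decode a) (decode b)) then after b else dead
      accept : Fin (2 + n) → Bool
      accept (suc (suc a)) = does (final? (decode a))
      accept _             = false

    open DFA localDFA using (run)

    dead-rejects : ∀ w → DFA.accept localDFA (run dead w) ≡ false
    dead-rejects []      = refl
    dead-rejects (_ ∷ w) = dead-rejects w

    linked⇒accepted : ∀ a w → Linked (decode a) (map decode w) → DFA.accept localDFA (run (after a) w) ≡ true
    linked⇒accepted a []      fin = dec-true (final? (decode a)) fin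
    linked⇒accepted a (b ∷ w) (a⇢b , l) rewrite dec-true (follows? (decode a) (decode b)) a⇢b =
      linked⇒accepted b w l

    accepted⇒linked : ∀ a w → DFA.accept localDFA (run (after a) w) ≡ true → Linked (decode a) (map decode w)
    accepted⇒linked a [] acc with final? (decode a)
    ... | yes fin = fin
    accepted⇒linked a (b ∷ w) acc with follows? (decode a) (decode b)
    ... | yes a⇢b = a⇢b , accepted⇒linked b w acc
    ... | no  _   with () ← trans (sym (dead-rejects w)) acc

    local-regular : IsRegular (Local ∘ map decode)
    local-regular = localDFA , λ w → accepts w , recognises w
      where
      accepts : ∀ w → Local (map decode w) → DFA.DLang localDFA w
      accepts (a ∷ w) (init , l) rewrite dec-true (initial? (decode a)) init = linked⇒accepted a w l
      recognises : ∀ w → DFA.DLang localDFA w → Local (map decode w)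
      recognises [] ()
      recognises (a ∷ w) acc with initial? (decode a)
      ... | yes init = init , accepted⇒linked a w acc
      ... | no  _    with () ← trans (sym (dead-rejects w)) acc

data Side : Set where
  left right : Side

finite-Side : Finite Side
finite-Side = 2 , mk↔ₛ′ to from (λ { zero → refl ; (suc zero) → refl })
                                (λ { left → refl ; right → refl })
  where
  to : Side → Fin 2
  to left  = zero
  to right = suc zero
  from : Fin 2 → Side
  from zero    = left
  from (suc _) = right

data StackOp (Γ : Set) : Set where
  push pop : Γ → StackOp Γ
  close    : StackOp Γ

-- 'edge s' and 'skip' never fire.  The return vector of the abstract
-- transition of 'edge s' is what closing stack s leaves at the root of the net.
data Op (Γ : Set) : Set where
  on   : Side → StackOp Γ → Op Γ
  edge : Side → Op Γ
  skip : Op Γ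

-- Stacks are listed top first; nothing is a closed stack.
Stack : Set → Set
Stack Γ = Maybe (List Γ)

Config : Set → Set
Config Γ = Stack Γ × Stack Γ

module _ {Γ : Set} where

  closed : Config Γ
  closed = nothing , nothing

  data StackStep : StackOp Γ → Stack Γ → Stack Γ → Set where
    push-step  : ∀ {y xs} → StackStep (push y) (just xs) (just (y ∷ xs))
    pop-step   : ∀ {y xs} → StackStep (pop y) (just (y ∷ xs)) (just xs)
    close-step : StackStep close (just []) nothing

  data ConfigStep : Op Γ → Config Γ → Config Γ → Set where
    on-left  : ∀ {o a a' b} → StackStep o a a' → ConfigStep (on left o) (a , b) (a' , b)
    on-right : ∀ {o a b b'} → StackStep o b b' → ConfigStep (on right o) (a , b) (a , b')

  data Exec : List (Op Γ) → Config Γ → Config Γ → Set where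
    []  : ∀ {c} → Exec [] c c
    _∷_ : ∀ {o os c c' c''} → ConfigStep o c c' → Exec os c' c'' → Exec (o ∷ os) c c''

  exec-++ : ∀ {os os' c c' c''} → Exec os c c' → Exec os' c' c'' → Exec (os ++ os') c c''
  exec-++ []      r' = r'
  exec-++ (s ∷ r) r' = s ∷ exec-++ r r'

  exec-++⁻ : ∀ os {os' c c''} → Exec (os ++ os') c c'' →
             Σ (Config Γ) λ c' → Exec os c c' × Exec os' c' c''
  exec-++⁻ []       r       = _ , [] , r
  exec-++⁻ (_ ∷ os) (s ∷ r) with c' , r₁ , r₂ ← exec-++⁻ os r = c' , s ∷ r₁ , r₂

  stackStep-deterministic : ∀ {o a a₁ a₂} → StackStep o a a₁ → StackStep o a a₂ → a₁ ≡ a₂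
  stackStep-deterministic push-step  push-step  = refl
  stackStep-deterministic pop-step   pop-step   = refl
  stackStep-deterministic close-step close-step = refl

  configStep-deterministic : ∀ {o c c₁ c₂} → ConfigStep o c c₁ → ConfigStep o c c₂ → c₁ ≡ c₂
  configStep-deterministic (on-left st₁)  (on-left st₂)  = cong (_, _) (stackStep-deterministic st₁ st₂)
  configStep-deterministic (on-right st₁) (on-right st₂) = cong (_ ,_) (stackStep-deterministic st₁ st₂)

  exec-deterministic : ∀ {os c c₁ c₂} → Exec os c c₁ → Exec os c c₂ → c₁ ≡ c₂
  exec-deterministic []        []        = refl
  exec-deterministic (s₁ ∷ r₁) (s₂ ∷ r₂) with refl ← configStep-deterministic s₁ s₂ =
    exec-deterministic r₁ r₂

module TwoStackNet {Γ : Set} {n : ℕ} (code : Γ → Fin n)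
                   (code-injective : ∀ {x y} → code x ≡ code y → x ≡ y)
                   {k : ℕ} (opOf : Fin k → Op Γ) where

  -- activeP s marks the top thread of stack s, baseP and cellP y the cell held
  -- by a thread, doneP s the closing of stack s (at the root); neverP stays
  -- empty and disables every transition whose instruction does not use it.
  Place : Set
  Place = Fin (6 + n)

  activeP doneP : Side → Place
  activeP left  = zero
  activeP right = suc zero
  doneP   left  = suc (suc (suc zero))
  doneP   right = suc (suc (suc (suc zero)))

  baseP neverP : Place
  baseP  = suc (suc zero)
  neverP = suc (suc (suc (suc (suc zero))))

  data Cell : Set where
    base : Cell
    cell : Γ → Cell

  cellP : Cell → Place
  cellP base     = baseP
  cellP (cell y) = 6 ↑ʳ code y

  cutOp : Cell → StackOp Γ
  cutOp base     = close
  cutOp (cell y) = pop y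

  token : Place → Marking (6 + n)
  token i j = if does (i ≟ j) then 1 else 0

  ∅ : Marking (6 + n)
  ∅ _ = 0

  token-self : ∀ i → token i i ≡ 1
  token-self i rewrite dec-true (i ≟ i) refl = refl

  token-≢ : ∀ {i j} → i ≢ j → token i j ≡ 0
  token-≢ {i} {j} i≢j rewrite dec-false (i ≟ j) i≢j = refl

  activeP-injective : ∀ {s s'} → activeP s ≡ activeP s' → s ≡ s'
  activeP-injective {left}  {left}  _ = refl
  activeP-injective {right} {right} _ = refl

  doneP-injective : ∀ {s s'} → doneP s ≡ doneP s' → s ≡ s'
  doneP-injective {left}  {left}  _ = refl
  doneP-injective {right} {right} _ = refl

  cellP-injective : ∀ {c c'} → cellP c ≡ cellP c' → c ≡ c'
  cellP-injective {base}  {base}   _  = refl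
  cellP-injective {cell y} {cell y'} eq = cong cell (code-injective (↑ʳ-injective 6 _ _ eq))

  cellP≢activeP : ∀ c s → cellP c ≢ activeP s
  cellP≢activeP base     left  ()
  cellP≢activeP base     right ()
  cellP≢activeP (cell _) left  ()
  cellP≢activeP (cell _) right ()

  cellP≢doneP : ∀ c s → cellP c ≢ doneP s
  cellP≢doneP base     left  ()
  cellP≢doneP base     right ()
  cellP≢doneP (cell _) left  ()
  cellP≢doneP (cell _) right ()

  cellP≢neverP : ∀ c → cellP c ≢ neverP
  cellP≢neverP base     ()
  cellP≢neverP (cell _) ()

  activeP≢doneP : ∀ s s' → activeP s ≢ doneP s'
  activeP≢doneP left  left  ()
  activeP≢doneP left  right ()
  activeP≢doneP right left  ()
  activeP≢doneP right right ()

  activeP≢neverP : ∀ s → activeP s ≢ neverP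
  activeP≢neverP left  ()
  activeP≢neverP right ()

  doneP≢neverP : ∀ s → doneP s ≢ neverP
  doneP≢neverP left  ()
  doneP≢neverP right ()

  _≟ˢ_ : (s s' : Side) → Dec (s ≡ s')
  s ≟ˢ s' = map′ activeP-injective (cong activeP) (activeP s ≟ activeP s')

  _≟ᶜ_ : (c c' : Cell) → Dec (c ≡ c')
  c ≟ᶜ c' = map′ cellP-injective (cong cellP) (cellP c ≟ cellP c')

  top : Side → Cell → Marking (6 + n)
  top s c = token (cellP c) +M token (activeP s)

  absPre absPost spawn cutPre : Op Γ → Marking (6 + n)
  absPre (on s (push _)) = token (activeP s)
  absPre _               = token neverP
  absPost (on s (push _)) = token (activeP s)
  absPost (edge s)        = token (doneP s)
  absPost _               = ∅
  spawn (on s (push y)) = top s (cell y)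
  spawn _               = ∅
  cutPre (on s (pop y)) = top s (cell y)
  cutPre (on s close)   = top s base
  cutPre _              = token neverP

  cutPre-cutOp : ∀ s c → cutPre (on s (cutOp c)) ≡ top s c
  cutPre-cutOp s base     = refl
  cutPre-cutOp s (cell _) = refl

  net : LRPN k
  net = record
    { p = 6 + n ; nel = 0 ; nab = k ; ncut = k
    ; W⁻el = λ () ; W⁺el = λ () ; labEl = λ ()
    ; W⁻ab = absPre ∘ opOf ; W⁺ab = absPost ∘ opOf ; Ω = spawn ∘ opOf ; labAb = just
    ; W⁻cut = cutPre ∘ opOf ; labCut = just }

  Transition : Set
  Transition = T net

  NetTree : Set
  NetTree = TTree net

  absT cutT : Fin k → Transition
  absT i = inj₂ (inj₁ i)
  cutT i = inj₂ (inj₂ i)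

  label : Transition → Fin k
  label (inj₁ ())
  label (inj₂ (inj₁ i)) = i
  label (inj₂ (inj₂ i)) = i

  λ*≡map-label : ∀ σ → λ* net σ ≡ map label σ
  λ*≡map-label []                  = refl
  λ*≡map-label (inj₁ () ∷ _)
  λ*≡map-label (inj₂ (inj₁ _) ∷ σ) = cong (_ ∷_) (λ*≡map-label σ)
  λ*≡map-label (inj₂ (inj₂ _) ∷ σ) = cong (_ ∷_) (λ*≡map-label σ)

  disabled : ∀ {W M X : Marking (6 + n)} i → 1 ≤ W i → M ≗ X → X i ≡ 0 → ¬ (W ≤M M)
  disabled i 1≤W M≗X X≡0 W≤M = ℕ.n≮0 (subst (1 ≤_) (trans (M≗X i) X≡0) (≤-trans 1≤W (W≤M i)))

  token-covers : ∀ i → 1 ≤ token i i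
  token-covers i = ≤-reflexive (sym (token-self i))

  cut-covers-cell : ∀ s c → 1 ≤ cutPre (on s (cutOp c)) (cellP c)
  cut-covers-cell s c rewrite cutPre-cutOp s c = ≤-trans (token-covers (cellP c)) (m≤m+n _ _)

  cut-covers-active : ∀ s c → 1 ≤ cutPre (on s (cutOp c)) (activeP s)
  cut-covers-active s c rewrite cutPre-cutOp s c = ≤-trans (token-covers (activeP s)) (m≤n+m _ _)

  top-other-active : ∀ s c {s'} → s' ≢ s → top s c (activeP s') ≡ 0
  top-other-active s c s'≢s =
    cong₂ _+_ (token-≢ (cellP≢activeP c _)) (token-≢ (s'≢s ∘ sym ∘ activeP-injective))

  top-other-cell : ∀ s c {c'} → c' ≢ c → top s c (cellP c') ≡ 0
  top-other-cell s c {c'} c'≢c =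
    cong₂ _+_ (token-≢ (c'≢c ∘ sym ∘ cellP-injective)) (token-≢ (cellP≢activeP c' s ∘ sym))

  Passive : Marking (6 + n) → Set
  Passive X = (∀ s → X (activeP s) ≡ 0) × X neverP ≡ 0

  data AbsView : Op Γ → Set where
    push-view  : ∀ s y → AbsView (on s (push y))
    inert-view : ∀ {o} → absPre o ≡ token neverP → AbsView o

  absView : ∀ o → AbsView o
  absView (on s (push y)) = push-view s y
  absView (on _ (pop _))  = inert-view refl
  absView (on _ close)    = inert-view refl
  absView (edge _)        = inert-view refl
  absView skip            = inert-view refl

  data CutView : Op Γ → Set where
    cut-view   : ∀ s c → CutView (on s (cutOp c))
    inert-view : ∀ {o} → cutPre o ≡ token neverP → CutView o

  cutView : ∀ o → CutView o
  cutView (on s (pop y))  = cut-view s (cell y)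
  cutView (on s close)    = cut-view s base
  cutView (on _ (push _)) = inert-view refl
  cutView (edge _)        = inert-view refl
  cutView skip            = inert-view refl

  never-covered : ∀ {W} → W ≡ token neverP → 1 ≤ W neverP
  never-covered refl = token-covers neverP

  passive-abs-disabled : ∀ {M X} o → Passive X → M ≗ X → ¬ (absPre o ≤M M)
  passive-abs-disabled o (act , nev) M≗ with absView o
  ... | push-view s _ = disabled (activeP s) (token-covers (activeP s)) M≗ (act s)
  ... | inert-view eq = disabled neverP (never-covered eq) M≗ nev

  passive-cut-disabled : ∀ {M X} o → Passive X → M ≗ X → ¬ (cutPre o ≤M M)
  passive-cut-disabled o (act , nev) M≗ with cutView o
  ... | cut-view s c  = disabled (activeP s) (cut-covers-active s c) M≗ (act s)
  ... | inert-view eq = disabled neverP (never-covered eq) M≗ nev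

  cell-passive : ∀ c → Passive (token (cellP c))
  cell-passive c = (λ s → token-≢ (cellP≢activeP c s)) , token-≢ (cellP≢neverP c)

  top-never : ∀ s c → top s c neverP ≡ 0
  top-never s c = cong₂ _+_ (token-≢ (cellP≢neverP c)) (token-≢ (activeP≢neverP s))

  top-push : ∀ s c {M} o → M ≗ top s c → absPre o ≤M M → Σ Γ λ y → o ≡ on s (push y)
  top-push s c o M≗ le with absView o
  ... | inert-view eq = ⊥-elim (disabled neverP (never-covered eq) M≗ (top-never s c) le)
  ... | push-view s' y with s' ≟ˢ s
  ...   | yes refl = y , refl
  ...   | no s'≢s  =
    ⊥-elim (disabled (activeP s') (token-covers (activeP s')) M≗ (top-other-active s c s'≢s) le)

  top-cut : ∀ s c {M} o → M ≗ top s c → cutPre o ≤M M → o ≡ on s (cutOp c)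
  top-cut s c o M≗ le with cutView o
  ... | inert-view eq = ⊥-elim (disabled neverP (never-covered eq) M≗ (top-never s c) le)
  ... | cut-view s' c' with s' ≟ˢ s | c' ≟ᶜ c
  ...   | yes refl | yes refl = refl
  ...   | no s'≢s  | _        =
    ⊥-elim (disabled (activeP s') (cut-covers-active s' c') M≗ (top-other-active s c s'≢s) le)
  ...   | yes refl | no c'≢c  =
    ⊥-elim (disabled (cellP c') (cut-covers-cell s c') M≗ (top-other-cell s c c'≢c) le)

  -- A stack of side s as a chain of threads, listed bottom first from the
  -- thread holding the cell c; only the top thread carries the token activeP s.
  Chain : Side → Cell → List Γ → NetTree → Set
  Chain s c []       (node M cs) = M ≗ top s c × cs ≡ []
  Chain s c (y ∷ ys) (node M cs) = M ≗ token (cellP c) × Σ (Fin k) λ a → Σ NetTree λ t →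
    cs ≡ (a , t) ∷ [] × absPost (opOf a) ≗ token (activeP s) × Chain s (cell y) ys t

  data ChainMove (s : Side) (c : Cell) (bs : List Γ) (τ : Transition) : Maybe NetTree → Set where
    pushed   : ∀ {y t'} → opOf (label τ) ≡ on s (push y) → Chain s c (bs ∷ʳ y) t' →
               ChainMove s c bs τ (just t')
    popped   : ∀ {y bs' t'} → opOf (label τ) ≡ on s (pop y) → bs ≡ bs' ∷ʳ y → Chain s c bs' t' →
               ChainMove s c bs τ (just t')
    vanished : bs ≡ [] → opOf (label τ) ≡ on s (cutOp c) → ChainMove s c bs τ nothing

  ∸-top : ∀ s c {M} → M ≗ top s c → (M ∸M token (activeP s)) ≗ token (cellP c)
  ∸-top s c M≗ i =
    trans (cong (_∸ token (activeP s) i) (M≗ i)) (m+n∸n≡m (token (cellP c) i) (token (activeP s) i))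

  +-top : ∀ s c {M W} → M ≗ token (cellP c) → W ≗ token (activeP s) → (M +M W) ≗ top s c
  +-top _ _ M≗ W≗ i = cong₂ _+_ (M≗ i) (W≗ i)

  pushed-chain : ∀ s c {M} a {y} → opOf a ≡ on s (push y) → M ≗ top s c →
    Chain s c (y ∷ []) (node (M ∸M absPre (opOf a)) ((a , node (spawn (opOf a)) []) ∷ []))
  pushed-chain s c a eq M≗ rewrite eq =
    ∸-top s c M≗ , a , _ , refl , (λ j → cong (λ o → absPost o j) eq) , (λ _ → refl) , refl

  chain-fire : ∀ {s c bs t τ r} → Chain s c bs t → Fire net t τ r → ChainMove s c bs τ r
  chain-fire _ (fire-el () _)
  chain-fire {s} {c} {[]} (M≗ , refl) (fire-ab a le) with y , eq ← top-push s c (opOf a) M≗ le =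
    pushed eq (pushed-chain s c a eq M≗)
  chain-fire {s} {c} {[]} (M≗ , refl) (fire-cut a le) = vanished refl (top-cut s c (opOf a) M≗ le)
  chain-fire {bs = []} (_ , cs≡) (fire-in pre _ _ _)     = ⊥-elim (++-∷-≢-[] pre cs≡)
  chain-fire {bs = []} (_ , cs≡) (fire-in-cut pre _ _ _) = ⊥-elim (++-∷-≢-[] pre cs≡)
  chain-fire {c = c} {bs = _ ∷ _} (M≗ , _) (fire-ab a le) =
    ⊥-elim (passive-abs-disabled (opOf a) (cell-passive c) M≗ le)
  chain-fire {c = c} {bs = _ ∷ _} (M≗ , _) (fire-cut a le) =
    ⊥-elim (passive-cut-disabled (opOf a) (cell-passive c) M≗ le)
  chain-fire {bs = y ∷ _} (M≗ , a , t , cs≡ , W≗ , ch) (fire-in pre post _ f)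
    with refl , refl , refl ← ∷-position-in-[ a , t ] cs≡ | chain-fire ch f
  ... | pushed eq ch'                = pushed eq (M≗ , a , _ , refl , W≗ , ch')
  ... | popped {bs' = bs'} eq refl ch' = popped {bs' = y ∷ bs'} eq refl (M≗ , a , _ , refl , W≗ , ch')
  chain-fire {s} {c} {bs = y ∷ _} (M≗ , a , t , cs≡ , W≗ , ch) (fire-in-cut pre post _ f)
    with refl , refl , refl ← ∷-position-in-[ a , t ] cs≡ | chain-fire ch f
  ... | vanished refl eq = popped {bs' = []} eq refl (+-top s c M≗ W≗ , refl)

  chain-push : ∀ {s c bs t} i {y} → opOf i ≡ on s (push y) → Chain s c bs t →
               Σ NetTree λ t' → Fire net t (absT i) (just t') × Chain s c (bs ∷ʳ y) t'
  chain-push {s} {c} {[]} {node M .[]} i eq (M≗ , refl) = _ , fire-ab i enabled , pushed-chain s c i eq M≗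
    where
    enabled : absPre (opOf i) ≤M M
    enabled j rewrite eq | M≗ j = m≤n+m _ _
  chain-push {bs = _ ∷ _} {node M .((a , t) ∷ [])} i eq (M≗ , a , t , refl , W≗ , ch)
    with t' , f , ch' ← chain-push i eq ch = _ , fire-in [] [] a f , (M≗ , a , t' , refl , W≗ , ch')

  chain-vanish : ∀ {s c t} i → opOf i ≡ on s (cutOp c) → Chain s c [] t → Fire net t (cutT i) nothing
  chain-vanish {s} {c} {node M .[]} i eq (M≗ , refl) = fire-cut i enabled
    where
    enabled : cutPre (opOf i) ≤M M
    enabled j rewrite eq | cutPre-cutOp s c | M≗ j = ≤-reflexive refl

  chain-pop : ∀ {s c t} bs i {y} → opOf i ≡ on s (pop y) → Chain s c (bs ∷ʳ y) t →
              Σ NetTree λ t' → Fire net t (cutT i) (just t') × Chain s c bs t'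
  chain-pop {s} {c} {node M .((a , t) ∷ [])} [] i eq (M≗ , a , t , refl , W≗ , ch) =
    _ , fire-in-cut [] [] a (chain-vanish i eq ch) , (+-top s c M≗ W≗ , refl)
  chain-pop {t = node M .((a , t) ∷ [])} (_ ∷ bs) i eq (M≗ , a , t , refl , W≗ , ch)
    with t' , f , ch' ← chain-pop bs i eq ch = _ , fire-in [] [] a f , (M≗ , a , t' , refl , W≗ , ch')

  doneIf : Side → Stack Γ → Marking (6 + n)
  doneIf s nothing  = token (doneP s)
  doneIf s (just _) = ∅

  StackChild : Side → List Γ → Child net → Set
  StackChild s xs (e , t) = absPost (opOf e) ≗ token (doneP s) × Chain s base (reverse xs) t

  Branch : Side → Stack Γ → Maybe (Child net) → Set
  Branch s nothing   nothing  = ⊤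
  Branch s (just xs) (just x) = StackChild s xs x
  Branch _ _         _        = ⊥

  Represents : Config Γ → NetTree → Set
  Represents (a , b) (node M cs) = M ≗ doneIf left a +M doneIf right b ×
    Σ (Maybe (Child net)) λ l → Σ (Maybe (Child net)) λ r →
      cs ≡ fromMaybe l ++ fromMaybe r × Branch left a l × Branch right b r

  root-passive : ∀ a b → Passive (doneIf left a +M doneIf right b)
  root-passive a b = (λ s → cong₂ _+_ (done-active left a s) (done-active right b s)) ,
                     cong₂ _+_ (done-never left a) (done-never right b)
    where
    done-active : ∀ s m s' → doneIf s m (activeP s') ≡ 0
    done-active s nothing  s' = token-≢ (activeP≢doneP s' s ∘ sym)
    done-active s (just _) s' = refl
    done-never : ∀ s m → doneIf s m neverP ≡ 0
    done-never s nothing  = token-≢ (doneP≢neverP s)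
    done-never s (just _) = refl

  stack-child-move : ∀ {s xs e t τ t'} → StackChild s xs (e , t) → Fire net t τ (just t') →
    Σ (StackOp Γ) λ o → opOf (label τ) ≡ on s o × Σ (List Γ) λ xs' →
      StackStep o (just xs) (just xs') × StackChild s xs' (e , t')
  stack-child-move {xs = xs} (W≗ , ch) f with chain-fire ch f
  ... | pushed {y} eq ch' = push y , eq , y ∷ xs , push-step ,
        W≗ , subst (λ bs → Chain _ base bs _) (sym (unfold-reverse y xs)) ch'
  ... | popped {y} {bs'} eq bs≡ ch' with refl ← reverse-≡-∷ʳ {xs = xs} bs≡ = pop y , eq , reverse bs' , pop-step ,
        W≗ , subst (λ bs → Chain _ base bs _) (sym (reverse-selfInverse refl)) ch'

  stack-child-vanish : ∀ {s xs e t τ} → StackChild s xs (e , t) → Fire net t τ nothing →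
    opOf (label τ) ≡ on s close × xs ≡ []
  stack-child-vanish (_ , ch) f with chain-fire ch f
  ... | vanished bs≡ eq = eq , sym (reverse-selfInverse bs≡)

  open-branch : ∀ {s m x} → Branch s m (just x) → Σ (List Γ) λ xs → m ≡ just xs × StackChild s xs x
  open-branch {m = just xs} ch = xs , refl , ch

  branch-child : ∀ {s xs l} → Branch s (just xs) l → Σ (Child net) λ x → l ≡ just x × StackChild s xs x
  branch-child {l = just x} ch = x , refl , ch

  closed-left : ∀ {M W : Marking (6 + n)} b → M ≗ ∅ +M doneIf right b → W ≗ token (doneP left) →
                (M +M W) ≗ doneIf left nothing +M doneIf right b
  closed-left b M≗ W≗ j = trans (cong₂ _+_ (M≗ j) (W≗ j)) (+-comm (doneIf right b j) _)

  closed-right : ∀ {M W : Marking (6 + n)} a → M ≗ doneIf left a +M ∅ → W ≗ token (doneP right) →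
                 (M +M W) ≗ doneIf left a +M doneIf right nothing
  closed-right a M≗ W≗ j = cong₂ _+_ (trans (M≗ j) (+-identityʳ (doneIf left a j))) (W≗ j)

  root-fire : ∀ {c t τ r} → Represents c t → Fire net t τ r →
    Σ (Config Γ) λ c' → ConfigStep (opOf (label τ)) c c' × Σ NetTree λ t' → r ≡ just t' × Represents c' t'
  root-fire _ (fire-el () _)
  root-fire {a , b} (M≗ , _) (fire-ab e le) = ⊥-elim (passive-abs-disabled (opOf e) (root-passive a b) M≗ le)
  root-fire {a , b} (M≗ , _) (fire-cut e le) = ⊥-elim (passive-cut-disabled (opOf e) (root-passive a b) M≗ le)
  root-fire {a , b} (M≗ , l , r , cs≡ , bl , br) (fire-in pre post e f)
    with ∷-position-in-fromMaybe-++ pre post l r cs≡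
  ... | inj₁ (refl , refl , refl) with xs , refl , ch ← open-branch bl
    with o , eq , xs' , st , ch' ← stack-child-move ch f =
    (just xs' , b) , subst (λ o → ConfigStep o _ _) (sym eq) (on-left st) , _ , refl ,
    (M≗ , just _ , r , refl , ch' , br)
  ... | inj₂ (refl , refl , refl) with xs , refl , ch ← open-branch br
    with o , eq , xs' , st , ch' ← stack-child-move ch f =
    (a , just xs') , subst (λ o → ConfigStep o _ _) (sym eq) (on-right st) , _ , refl ,
    (M≗ , l , just _ , refl , bl , ch')
  root-fire {a , b} (M≗ , l , r , cs≡ , bl , br) (fire-in-cut pre post e f)
    with ∷-position-in-fromMaybe-++ pre post l r cs≡
  ... | inj₁ (refl , refl , refl) with xs , refl , ch ← open-branch bl
    with eq , refl ← stack-child-vanish {xs = xs} ch f =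
    (nothing , b) , subst (λ o → ConfigStep o _ _) (sym eq) (on-left close-step) , _ , refl ,
    (closed-left b M≗ (proj₁ ch) , nothing , r , refl , tt , br)
  ... | inj₂ (refl , refl , refl) with xs , refl , ch ← open-branch br
    with eq , refl ← stack-child-vanish {xs = xs} ch f =
    (a , nothing) , subst (λ o → ConfigStep o _ _) (sym eq) (on-right close-step) , _ , refl ,
    (closed-right a M≗ (proj₁ ch) , l , nothing , refl , bl , tt)

  stack-child-step : ∀ {s o xs xs' e t} i → opOf i ≡ on s o → StackStep o (just xs) (just xs') →
    StackChild s xs (e , t) →
    Σ Transition λ τ → label τ ≡ i × Σ NetTree λ t' → Fire net t τ (just t') × StackChild s xs' (e , t')
  stack-child-step {xs = xs} i eq (push-step {y}) (W≗ , ch) with t' , f , ch' ← chain-push i eq ch =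
    absT i , refl , t' , f , W≗ , subst (λ bs → Chain _ base bs t') (sym (unfold-reverse y xs)) ch'
  stack-child-step i eq (pop-step {y} {xs}) (W≗ , ch)
    with t' , f , ch' ← chain-pop (reverse xs) i eq (subst (λ bs → Chain _ base bs _) (unfold-reverse y xs) ch) =
    cutT i , refl , t' , f , W≗ , ch'

  Moves : Config Γ → Fin k → NetTree → Config Γ → Set
  Moves c i t c' = Σ Transition λ τ → label τ ≡ i × Σ NetTree λ t' → Fire net t τ (just t') × Represents c' t'

  step-left : ∀ {o xs xs' b t} i → opOf i ≡ on left o → StackStep o (just xs) (just xs') →
              Represents (just xs , b) t → Moves (just xs , b) i t (just xs' , b)
  step-left {t = node _ _} i eq st (M≗ , l , r , refl , bl , br) with (e , t) , refl , ch ← branch-child bl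
    with τ , τ≡ , t' , f , ch' ← stack-child-step i eq st ch =
    τ , τ≡ , _ , fire-in [] _ e f , (M≗ , just (e , t') , r , refl , ch' , br)

  step-right : ∀ {o a xs xs' t} i → opOf i ≡ on right o → StackStep o (just xs) (just xs') →
               Represents (a , just xs) t → Moves (a , just xs) i t (a , just xs')
  step-right {t = node _ _} i eq st (M≗ , l , r , refl , bl , br) with (e , t) , refl , ch ← branch-child br
    with τ , τ≡ , t' , f , ch' ← stack-child-step i eq st ch =
    τ , τ≡ , _ , fire-in _ [] e f , (M≗ , l , just (e , t') , refl , bl , ch')

  close-left : ∀ {b t} i → opOf i ≡ on left close → Represents (just [] , b) t →
               Moves (just [] , b) i t (nothing , b)
  close-left {b} {node _ _} i eq (M≗ , l , r , refl , bl , br) with (e , t) , refl , (W≗ , ch) ← branch-child bl =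
    cutT i , refl , _ , fire-in-cut [] _ e (chain-vanish i eq ch) ,
    (closed-left b M≗ W≗ , nothing , r , refl , tt , br)

  close-right : ∀ {a t} i → opOf i ≡ on right close → Represents (a , just []) t →
                Moves (a , just []) i t (a , nothing)
  close-right {a} {node _ _} i eq (M≗ , l , r , refl , bl , br)
    with (e , t) , refl , (W≗ , ch) ← branch-child br =
    cutT i , refl , _ , fire-in-cut _ [] e (chain-vanish i eq ch) ,
    (closed-right a M≗ W≗ , l , nothing , refl , bl , tt)

  root-step : ∀ {o c c' t} i → opOf i ≡ o → ConfigStep o c c' → Represents c t → Moves c i t c'
  root-step i eq (on-left push-step)   = step-left i eq push-step
  root-step i eq (on-left pop-step)    = step-left i eq pop-step
  root-step i eq (on-left close-step)  = close-left i eq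
  root-step i eq (on-right push-step)  = step-right i eq push-step
  root-step i eq (on-right pop-step)   = step-right i eq pop-step
  root-step i eq (on-right close-step) = close-right i eq

  steps⇒exec : ∀ {c t σ s} → Represents c t → Steps net (just t) σ s →
    Σ (Config Γ) λ c' → Exec (map (opOf ∘ label) σ) c c' ×
    Σ NetTree λ t' → s ≡ just t' × Represents c' t'
  steps⇒exec rep done = _ , [] , _ , refl , rep
  steps⇒exec rep (more (step f) rest) with _ , st , _ , refl , rep₁ ← root-fire rep f
    with c' , ex , t' , s≡ , rep' ← steps⇒exec rep₁ rest = c' , st ∷ ex , t' , s≡ , rep'

  exec⇒steps : ∀ {c c' t} w → Represents c t → Exec (map opOf w) c c' →
    Σ (List Transition) λ σ → map label σ ≡ w ×
    Σ NetTree λ t' → Steps net (just t) σ (just t') × Represents c' t'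
  exec⇒steps []      rep []        = [] , refl , _ , done , rep
  exec⇒steps (i ∷ w) rep (st ∷ ex) with τ , refl , _ , f , rep₁ ← root-step i refl st rep
    with σ , refl , t' , steps , rep' ← exec⇒steps w rep₁ ex = τ ∷ σ , refl , t' , more (step f) steps , rep'

  finalTree : NetTree
  finalTree = node (token (doneP left) +M token (doneP right)) []

  final-done : ∀ s → 1 ≤ (token (doneP left) +M token (doneP right)) (doneP s)
  final-done left  = ≤-trans (token-covers (doneP left)) (m≤m+n _ (token (doneP right) (doneP left)))
  final-done right = ≤-trans (token-covers (doneP right)) (m≤n+m _ (token (doneP left) (doneP right)))

  doneIf-elsewhere : ∀ s m {s'} → s ≢ s' → doneIf s m (doneP s') ≡ 0
  doneIf-elsewhere s nothing  s≢s' = token-≢ (s≢s' ∘ doneP-injective)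
  doneIf-elsewhere s (just _) _    = refl

  closed-covered : ∀ {t} → Represents closed t → SubEmb net finalTree t
  closed-covered {node _ _} (M≗ , _) = here (emb (λ j → ≤-reflexive (sym (M≗ j))) ec-nil)

  chain-uncovered : ∀ {s c bs t} → Chain s c bs t → ¬ SubEmb net finalTree t
  chain-uncovered {s} {c} {[]} {node _ _} (M≗ , _) (here (emb le _)) = disabled (doneP left) (final-done left) M≗
    (cong₂ _+_ (token-≢ (cellP≢doneP c left)) (token-≢ (activeP≢doneP s left))) le
  chain-uncovered {bs = []} {node _ .[]} (_ , refl) (there () _)
  chain-uncovered {c = c} {_ ∷ _} {node _ _} (M≗ , _) (here (emb le _)) =
    disabled (doneP left) (final-done left) M≗ (token-≢ (cellP≢doneP c left)) le
  chain-uncovered {bs = _ ∷ _} {node _ _} (_ , _ , _ , refl , _ , ch) (there (here refl) sub) = chain-uncovered ch sub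
  chain-uncovered {bs = _ ∷ _} {node _ _} (_ , _ , _ , refl , _ , _)  (there (there ()) _)

  branch-uncovered : ∀ {s m l a t} → Branch s m l → (a , t) ∈ fromMaybe l → ¬ SubEmb net finalTree t
  branch-uncovered {m = just _} {just _} (_ , ch) (here refl) = chain-uncovered ch

  covered⇒closed : ∀ {c t} → Represents c t → SubEmb net finalTree t → c ≡ closed
  covered⇒closed {nothing , nothing} _ _ = refl
  covered⇒closed {just _ , b} {node _ _} (M≗ , _) (here (emb le _)) =
    ⊥-elim (disabled (doneP left) (final-done left) M≗ (doneIf-elsewhere right b {left} λ ()) le)
  covered⇒closed {nothing , just _} {node _ _} (M≗ , _) (here (emb le _)) =
    ⊥-elim (disabled (doneP right) (final-done right) M≗ (+-identityʳ _ ) le)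
  covered⇒closed {t = node _ _} (_ , l , _ , refl , bl , br) (there x∈ sub) with ∈-++⁻ (fromMaybe l) x∈
  ... | inj₁ x∈l = ⊥-elim (branch-uncovered bl x∈l sub)
  ... | inj₂ x∈r = ⊥-elim (branch-uncovered br x∈r sub)

  covers⇔exec : ∀ {c t} → Represents c t → ∀ w →
    CovLang net (just t) (just finalTree ∷ []) w ⇔ Exec (map opOf w) c closed
  covers⇔exec {c} {t} rep w = mk⇔ to from
    where
    to : CovLang net (just t) (just finalTree ∷ []) w → Exec (map opOf w) c closed
    to (σ , _ , steps , (_ , here refl , cov) , refl) with c' , ex , _ , refl , rep' ← steps⇒exec rep steps
      with refl ← covered⇒closed rep' cov =
      subst (λ os → Exec os c closed) (trans (map-∘ σ) (cong (map opOf) (sym (λ*≡map-label σ)))) ex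
    from : Exec (map opOf w) c closed → CovLang net (just t) (just finalTree ∷ []) w
    from ex with σ , σ≡ , t' , steps , rep' ← exec⇒steps w rep ex =
      σ , just t' , steps , (just finalTree , here refl , closed-covered rep') , trans (λ*≡map-label σ) σ≡

  module OpenTree (edgeCode : Side → Fin k) (edgeCode-op : ∀ s → opOf (edgeCode s) ≡ edge s)
                  (pushCode : Side → Γ → Fin k)
                  (pushCode-op : ∀ s y → opOf (pushCode s y) ≡ on s (push y)) where

    chainTree : Side → Cell → List Γ → NetTree
    chainTree s c []       = node (top s c) []
    chainTree s c (y ∷ ys) = node (token (cellP c)) ((pushCode s y , chainTree s (cell y) ys) ∷ [])

    chainTree-chain : ∀ s c ys → Chain s c ys (chainTree s c ys)
    chainTree-chain s c []       = (λ _ → refl) , refl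
    chainTree-chain s c (y ∷ ys) = (λ _ → refl) , _ , _ , refl ,
      (λ j → cong (λ o → absPost o j) (pushCode-op s y)) , chainTree-chain s (cell y) ys

    stackChild : Side → List Γ → Child net
    stackChild s xs = edgeCode s , chainTree s base (reverse xs)

    openTree : List Γ → List Γ → NetTree
    openTree A B = node ∅ (stackChild left A ∷ stackChild right B ∷ [])

    openTree-rep : ∀ A B → Represents (just A , just B) (openTree A B)
    openTree-rep A B = (λ _ → refl) , just _ , just _ , refl , stack-child left A , stack-child right B
      where
      stack-child : ∀ s xs → StackChild s xs (stackChild s xs)
      stack-child s xs = (λ j → cong (λ o → absPost o j) (edgeCode-op s)) , chainTree-chain s base (reverse xs)

module GrammarSimulation {k : ℕ} (G : Grammar k) where
  open Grammar G
  open Production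

  Symbol : Set
  Symbol = Sym k m

  _≟ʸ_ : DecidableEquality Symbol
  _≟ʸ_ = ≡-dec _≟_ _≟_

  axiom : List Symbol
  axiom = inj₂ start ∷ []

  infix 4 _⇒*_
  _⇒*_ : List Symbol → List Symbol → Set
  _⇒*_ = Derives G

  derives-snoc : ∀ {α β γ} → α ⇒* β → DStep G β γ → α ⇒* γ
  derives-snoc d-refl       s = d-step s d-refl
  derives-snoc (d-step s d) s' = d-step s (derives-snoc d s')

  pops pushes : List Symbol → List (Op Symbol)
  pops   = map (on right ∘ pop)
  pushes = map (on right ∘ push)

  rewriteOps : Production k m → List (Op Symbol)
  rewriteOps p = pops (lhs p) ++ pushes (reverse (rhs p))

  NP : ℕ
  NP = length prods

  production : Fin NP → Production k m
  production = lookup prods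

  ops : Fin NP → List (Op Symbol)
  ops = rewriteOps ∘ production

  width : ℕ
  width = sum (map (length ∘ rewriteOps) prods)

  ops≤width : ∀ p → length (ops p) ≤ width
  ops≤width = lookup-≤-sum (length ∘ rewriteOps) prods

  -- 'apply p j' performs the j-th operation of ops p; carrying the position
  -- in the letter is what lets a local language sequence these operations.
  data Instr : Set where
    grab put : Side → Symbol → Instr
    apply    : Fin NP → Fin width → Instr
    emit     : Fin k → Instr
    shut     : Side → Instr
    edge     : Side → Instr

  opAt : Fin NP → ℕ → Op Symbol
  opAt p j = Data.Maybe.fromMaybe skip (head (drop j (ops p)))

  op : Instr → Op Symbol
  op (grab s y)  = on s (pop y)
  op (put s y)   = on s (push y)
  op (apply p j) = opAt p (toℕ j)
  op (emit x)    = on right (pop (inj₁ x))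
  op (shut s)    = on s close
  op (edge s)    = edge s

  output : Instr → Word k
  output (emit x) = x ∷ []
  output _        = []

  outputs : List Instr → Word k
  outputs = concatMap output

  data Opens : Instr → Set where
    opens-grab  : ∀ {s y} → Opens (grab s y)
    opens-apply : ∀ {p j} → toℕ j ≡ 0 → Opens (apply p j)
    opens-shut  : Opens (shut left)

  data Emits : Instr → Set where
    emits-emit : ∀ {x} → Emits (emit x)
    emits-shut : Emits (shut right)

  data Puts (y : Symbol) : Instr → Set where
    puts : ∀ s → Puts y (put s y)

  data Continues (p : Fin NP) (j : Fin width) : Instr → Set where
    continues : ∀ {j'} → toℕ j' ≡ suc (toℕ j) → Continues p j (apply p j')

  data Final : Instr → Set where
    final : Final (shut right)

  _⇢_ : Instr → Instr → Set
  grab _ y  ⇢ b = Puts y b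
  put _ _   ⇢ b = Opens b
  apply p j ⇢ b = Continues p j b ⊎ (length (ops p) ≤ suc (toℕ j) × Opens b)
  emit _    ⇢ b = Emits b
  shut left ⇢ b = Emits b
  _         ⇢ _ = ⊥

  opens? : Decidable Opens
  opens? (grab _ _)   = yes opens-grab
  opens? (put _ _)    = no λ ()
  opens? (apply _ j)  = map′ opens-apply (λ { (opens-apply j≡0) → j≡0 }) (toℕ j ℕ.≟ 0)
  opens? (emit _)     = no λ ()
  opens? (shut left)  = yes opens-shut
  opens? (shut right) = no λ ()
  opens? (edge _)     = no λ ()

  emits? : Decidable Emits
  emits? (grab _ _)   = no λ ()
  emits? (put _ _)    = no λ ()
  emits? (apply _ _)  = no λ ()
  emits? (emit _)     = yes emits-emit
  emits? (shut left)  = no λ ()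
  emits? (shut right) = yes emits-shut
  emits? (edge _)     = no λ ()

  puts? : ∀ y → Decidable (Puts y)
  puts? y (grab _ _)   = no λ ()
  puts? y (put s y')   = map′ (λ { refl → puts s }) (λ { (puts _) → refl }) (y ≟ʸ y')
  puts? y (apply _ _)  = no λ ()
  puts? y (emit _)     = no λ ()
  puts? y (shut _)     = no λ ()
  puts? y (edge _)     = no λ ()

  continues? : ∀ p j → Decidable (Continues p j)
  continues? p j (grab _ _)   = no λ ()
  continues? p j (put _ _)    = no λ ()
  continues? p j (apply p' j') with p ≟ p' | toℕ j' ℕ.≟ suc (toℕ j)
  ... | yes refl | yes eq = yes (continues eq)
  ... | no p≢p'  | _      = no λ { (continues _) → p≢p' refl }
  ... | yes refl | no ¬eq = no λ { (continues eq) → ¬eq eq }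
  continues? p j (emit _)     = no λ ()
  continues? p j (shut _)     = no λ ()
  continues? p j (edge _)     = no λ ()

  follows? : Decidable₂ _⇢_
  follows? (grab _ y)   b = puts? y b
  follows? (put _ _)    b = opens? b
  follows? (apply p j)  b = continues? p j b ⊎-dec (length (ops p) ℕ.≤? suc (toℕ j) ×-dec opens? b)
  follows? (emit _)     b = emits? b
  follows? (shut left)  b = emits? b
  follows? (shut right) _ = no λ ()
  follows? (edge _)     _ = no λ ()

  final? : Decidable Final
  final? (grab _ _)   = no λ ()
  final? (put _ _)    = no λ ()
  final? (apply _ _)  = no λ ()
  final? (emit _)     = no λ ()
  final? (shut left)  = no λ ()
  final? (shut right) = yes final
  final? (edge _)     = no λ ()

  open LocalLanguage Opens _⇢_ Final public

  finite-Sy : Finite Symbol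
  finite-Sy = finite-⊎ (finite-Fin k) (finite-Fin m)

  finite-Instr : Finite Instr
  finite-Instr = finite-↔ (mk↔ₛ′ to from to-from from-to)
    (finite-⊎ (finite-× finite-Side finite-Sy) (finite-⊎ (finite-× finite-Side finite-Sy)
      (finite-⊎ (finite-× (finite-Fin NP) (finite-Fin width)) (finite-⊎ (finite-Fin k)
        (finite-⊎ finite-Side finite-Side)))))
    where
    Code : Set
    Code = (Side × Symbol) ⊎ (Side × Symbol) ⊎ (Fin NP × Fin width) ⊎ Fin k ⊎ Side ⊎ Side
    to : Instr → Code
    to (grab s y)  = inj₁ (s , y)
    to (put s y)   = inj₂ (inj₁ (s , y))
    to (apply p j) = inj₂ (inj₂ (inj₁ (p , j)))
    to (emit x)    = inj₂ (inj₂ (inj₂ (inj₁ x)))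
    to (shut s)    = inj₂ (inj₂ (inj₂ (inj₂ (inj₁ s))))
    to (edge s)    = inj₂ (inj₂ (inj₂ (inj₂ (inj₂ s))))
    from : Code → Instr
    from (inj₁ (s , y))                             = grab s y
    from (inj₂ (inj₁ (s , y)))                      = put s y
    from (inj₂ (inj₂ (inj₁ (p , j))))               = apply p j
    from (inj₂ (inj₂ (inj₂ (inj₁ x))))              = emit x
    from (inj₂ (inj₂ (inj₂ (inj₂ (inj₁ s)))))       = shut s
    from (inj₂ (inj₂ (inj₂ (inj₂ (inj₂ s)))))       = edge s
    to-from : ∀ c → to (from c) ≡ c
    to-from (inj₁ _)                         = refl
    to-from (inj₂ (inj₁ _))                  = refl
    to-from (inj₂ (inj₂ (inj₁ _)))           = refl
    to-from (inj₂ (inj₂ (inj₂ (inj₁ _))))    = refl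
    to-from (inj₂ (inj₂ (inj₂ (inj₂ (inj₁ _))))) = refl
    to-from (inj₂ (inj₂ (inj₂ (inj₂ (inj₂ _))))) = refl
    from-to : ∀ ι → from (to ι) ≡ ι
    from-to (grab _ _)  = refl
    from-to (put _ _)   = refl
    from-to (apply _ _) = refl
    from-to (emit _)    = refl
    from-to (shut _)    = refl
    from-to (edge _)    = refl

  nInstr : ℕ
  nInstr = proj₁ finite-Instr

  encode : Instr → Fin nInstr
  encode = Inverse.to (proj₂ finite-Instr)

  decode : Fin nInstr → Instr
  decode = Inverse.from (proj₂ finite-Instr)

  decode-encode : ∀ ι → decode (encode ι) ≡ ι
  decode-encode = Inverse.strictlyInverseʳ (proj₂ finite-Instr)

  code : Symbol → Fin (proj₁ finite-Sy)
  code = Inverse.to (proj₂ finite-Sy)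

  code-injective : ∀ {x y} → code x ≡ code y → x ≡ y
  code-injective = Injection.injective (↔⇒↣ (proj₂ finite-Sy))

  exec-pops : ∀ l {A v} → Exec (pops l) (just A , just (l ++ v)) (just A , just v)
  exec-pops []      = []
  exec-pops (_ ∷ l) = on-right pop-step ∷ exec-pops l

  exec-pops⁻ : ∀ l {A B c} → Exec (pops l) (just A , just B) c →
               Σ (List Symbol) λ v → B ≡ l ++ v × c ≡ (just A , just v)
  exec-pops⁻ []      []                       = _ , refl , refl
  exec-pops⁻ (_ ∷ l) (on-right pop-step ∷ ex) with v , refl , refl ← exec-pops⁻ l ex = v , refl , refl

  exec-pushes : ∀ l {A v} → Exec (pushes l) (just A , just v) (just A , just (reverse l ++ v))
  exec-pushes []          = []
  exec-pushes (y ∷ l) {A} {v} =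
    on-right push-step ∷ subst (λ B → Exec _ _ (just A , just B)) (sym (reverse-∷-++ y l v)) (exec-pushes l)

  exec-rewrite-rhs : ∀ p {A v} → Exec (pushes (reverse (rhs p))) (just A , just v) (just A , just (rhs p ++ v))
  exec-rewrite-rhs p {A} {v} =
    subst (λ β → Exec (pushes (reverse (rhs p))) (just A , just v) (just A , just (β ++ v))) (reverse-involutive (rhs p))
    (exec-pushes (reverse (rhs p)))

  exec-rewrite : ∀ p {A v} → Exec (rewriteOps p) (just A , just (lhs p ++ v)) (just A , just (rhs p ++ v))
  exec-rewrite p = exec-++ (exec-pops (lhs p)) (exec-rewrite-rhs p)

  exec-rewrite⁻ : ∀ p {A B c} → Exec (rewriteOps p) (just A , just B) c →
                  Σ (List Symbol) λ v → B ≡ lhs p ++ v × c ≡ (just A , just (rhs p ++ v))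
  exec-rewrite⁻ p ex with _ , ex₁ , ex₂ ← exec-++⁻ (pops (lhs p)) ex
    with v , refl , refl ← exec-pops⁻ (lhs p) ex₁ =
    v , refl , exec-deterministic ex₂ (exec-rewrite-rhs p)

  -- A configuration (just A , just B) stores the sentential form reverse A ++ B.
  Between : Config Symbol → Set
  Between c = Σ (List Symbol) λ A → Σ (List Symbol) λ B → c ≡ (just A , just B) × axiom ⇒* reverse A ++ B

  Carrying : Symbol → Config Symbol → Set
  Carrying y c = Σ (List Symbol) λ A → Σ (List Symbol) λ B → c ≡ (just A , just B) × axiom ⇒* reverse A ++ y ∷ B

  Rewriting : Fin NP → ℕ → Config Symbol → Set
  Rewriting p j c = Σ (List Symbol) λ A → Σ (List Symbol) λ B →
    axiom ⇒* reverse A ++ B × Exec (take j (ops p)) (just A , just B) c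

  Emitting : Config Symbol → Word k → Set
  Emitting c ws = Σ (List Symbol) λ B → c ≡ (nothing , just B) × axiom ⇒* map inj₁ ws ++ B

  Invariant : Instr → Config Symbol → Word k → Set
  Invariant (grab _ y)   c ws = ws ≡ [] × Carrying y c
  Invariant (put _ _)    c ws = ws ≡ [] × Between c
  Invariant (apply p j)  c ws = ws ≡ [] × Rewriting p (suc (toℕ j)) c
  Invariant (emit _)     c ws = Emitting c ws
  Invariant (shut left)  c ws = Emitting c ws
  Invariant (shut right) c ws = c ≡ closed × axiom ⇒* map inj₁ ws
  Invariant (edge _)     _ _  = ⊥

  rewriting-step : ∀ p j {c c'} → Rewriting p j c → ConfigStep (opAt p j) c c' → Rewriting p (suc j) c'
  rewriting-step p j (A , B , d , ex) st with head (drop j (ops p)) in eq | st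
  ... | just o | st' =
    A , B , d , subst (λ os → Exec os _ _) (sym (take-suc-head (ops p) j eq)) (exec-++ ex (st' ∷ []))

  rewriting-done : ∀ p j {c} → length (ops p) ≤ j → Rewriting p j c → Between c
  rewriting-done p j ℓ≤j (A , B , d , ex) with v , refl , refl ← exec-rewrite⁻ (production p)
    (subst (λ os → Exec os _ _) (take-all j (ops p) ℓ≤j) ex) =
    A , rhs (production p) ++ v , refl , derives-snoc d (dstep (reverse A) v (production p) (∈-lookup p))

  start-block : ∀ {b c c'} → Between c → Opens b → ConfigStep (op b) c c' → Invariant b c' (output b)
  start-block {grab left y} (_ , B , refl , d) _ (on-left (pop-step {xs = A})) =
    refl , A , B , refl , subst (axiom ⇒*_) (reverse-∷-++ y A B) d
  start-block {grab right y} (A , _ , refl , d) _ (on-right (pop-step {xs = B})) = refl , A , B , refl , d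
  start-block {apply p j} (A , B , refl , d) (opens-apply j≡0) st =
    refl , rewriting-step p (toℕ j) (A , B , d , subst (λ i → Exec (take i (ops p)) _ _) (sym j≡0) []) st
  start-block {shut left} (_ , B , refl , d) _ (on-left close-step) = B , refl , d

  emit-step : ∀ {b c c' ws} → Emitting c ws → Emits b → ConfigStep (op b) c c' →
              Invariant b c' (ws ++ output b)
  emit-step {emit x} {ws = ws} (_ , refl , d) _ (on-right (pop-step {xs = B})) =
    B , refl , subst (axiom ⇒*_) (sym (trans (cong (_++ B) (map-++ inj₁ ws (x ∷ [])))
                                           (++-assoc (map inj₁ ws) _ B))) d
  emit-step {shut right} {ws = ws} (_ , refl , d) _ (on-right close-step) =
    refl , subst (λ u → axiom ⇒* map inj₁ u) (sym (++-identityʳ ws)) (subst (axiom ⇒*_) (++-identityʳ _) d)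

  invariant-step : ∀ {a b c c' ws} → Invariant a c ws → a ⇢ b → ConfigStep (op b) c c' →
                   Invariant b c' (ws ++ output b)
  invariant-step {grab _ y} (refl , A , B , refl , d) (puts left) (on-left push-step) =
    refl , y ∷ A , B , refl , subst (axiom ⇒*_) (sym (reverse-∷-++ y A B)) d
  invariant-step {grab _ y} (refl , A , B , refl , d) (puts right) (on-right push-step) = refl , A , y ∷ B , refl , d
  invariant-step {put _ _}   (refl , btw) opens st = start-block btw opens st
  invariant-step {apply p j} (refl , rw) (inj₁ (continues j'≡)) st =
    refl , subst (λ i → Rewriting p (suc i) _) (sym j'≡) (rewriting-step p (suc (toℕ j)) rw
      (subst (λ i → ConfigStep (opAt p i) _ _) j'≡ st))
  invariant-step {apply p j} (refl , rw) (inj₂ (ℓ≤ , opens)) st =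
    start-block (rewriting-done p _ ℓ≤ rw) opens st
  invariant-step {emit _}     em emits st = emit-step em emits st
  invariant-step {shut left}  em emits st = emit-step em emits st

  linked⇒derivation : ∀ {a c ws} ιs → Invariant a c ws → Linked a ιs → Exec (map op ιs) c closed →
                      axiom ⇒* map inj₁ (ws ++ outputs ιs)
  linked⇒derivation {shut right} {ws = ws} [] (_ , d) final [] =
    subst (λ u → axiom ⇒* map inj₁ u) (sym (++-identityʳ ws)) d
  linked⇒derivation {ws = ws} (b ∷ ιs) inv (a⇢b , l) (st ∷ ex) =
    subst (λ u → axiom ⇒* map inj₁ u) (++-assoc ws (output b) (outputs ιs))
      (linked⇒derivation ιs (invariant-step inv a⇢b st) l ex)

  local⇒derivation : ∀ ιs → Local ιs → Exec (map op ιs) (just [] , just axiom) closed →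
                     axiom ⇒* map inj₁ (outputs ιs)
  local⇒derivation (b ∷ ιs) (opens , l) (st ∷ ex) =
    linked⇒derivation ιs (start-block ([] , axiom , refl , d-refl) opens st) l ex

  moveRight moveLeft : List Symbol → List Instr
  moveRight []      = []
  moveRight (y ∷ u) = grab right y ∷ put left y ∷ moveRight u
  moveLeft  []      = []
  moveLeft  (y ∷ u) = grab left y ∷ put right y ∷ moveLeft u

  exec-moveRight : ∀ u {A B} → Exec (map op (moveRight u)) (just A , just (u ++ B)) (just (reverse u ++ A) , just B)
  exec-moveRight []          = []
  exec-moveRight (y ∷ u) {A} {B} = on-right pop-step ∷ on-left push-step ∷
    subst (λ A' → Exec (map op (moveRight u)) (just (y ∷ A) , just (u ++ B)) (just A' , just B))
          (sym (reverse-∷-++ y u A)) (exec-moveRight u)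

  exec-moveLeft : ∀ u {A B} → Exec (map op (moveLeft u)) (just (u ++ A) , just B) (just A , just (reverse u ++ B))
  exec-moveLeft []          = []
  exec-moveLeft (y ∷ u) {A} {B} = on-left pop-step ∷ on-right push-step ∷
    subst (λ B' → Exec (map op (moveLeft u)) (just (u ++ A) , just (y ∷ B)) (just A , just B'))
          (sym (reverse-∷-++ y u B)) (exec-moveLeft u)

  local-move : ∀ s s' y {w} → Local w → Local (grab s y ∷ put s' y ∷ w)
  local-move s s' y loc = opens-grab , puts s' , linked-local id loc

  local-moveRight : ∀ u {w} → Local w → Local (moveRight u ++ w)
  local-moveRight []      loc = loc
  local-moveRight (y ∷ u) loc = local-move right left y (local-moveRight u loc)

  local-moveLeft : ∀ u {w} → Local w → Local (moveLeft u ++ w)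
  local-moveLeft []      loc = loc
  local-moveLeft (y ∷ u) loc = local-move left right y (local-moveLeft u loc)

  outputs-moveRight : ∀ u → outputs (moveRight u) ≡ []
  outputs-moveRight []      = refl
  outputs-moveRight (_ ∷ u) = outputs-moveRight u

  outputs-moveLeft : ∀ u → outputs (moveLeft u) ≡ []
  outputs-moveLeft []      = refl
  outputs-moveLeft (_ ∷ u) = outputs-moveLeft u

  applyRun : Fin NP → (ℓ : ℕ) → ℓ ≤ width → List Instr
  applyRun p ℓ ℓ≤ = tabulate λ (i : Fin ℓ) → apply p (inject≤ i ℓ≤)

  applyWord : Fin NP → List Instr
  applyWord p = applyRun p (length (ops p)) (ops≤width p)

  map-op-applyWord : ∀ p → map op (applyWord p) ≡ ops p
  map-op-applyWord p = begin
    map op (applyWord p)               ≡⟨ map-tabulate _ op ⟩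
    tabulate (op ∘ apply p ∘ position) ≡⟨ tabulate-cong lookup-op ⟩
    tabulate (lookup (ops p))          ≡⟨ tabulate-lookup (ops p) ⟩
    ops p                              ∎
    where
    open ≡-Reasoning
    position : Fin (length (ops p)) → Fin width
    position i = inject≤ i (ops≤width p)
    lookup-op : ∀ i → op (apply p (position i)) ≡ lookup (ops p) i
    lookup-op i rewrite toℕ-inject≤ i (ops≤width p) | head-drop-lookup (ops p) i = refl

  outputs-applies : ∀ p {ℓ} (g : Fin ℓ → Fin width) → outputs (tabulate (apply p ∘ g)) ≡ []
  outputs-applies p {zero}  g = refl
  outputs-applies p {suc ℓ} g = outputs-applies p (g ∘ suc)

  rewriteOps-nonempty : ∀ pr → 1 ≤ length (rewriteOps pr)
  rewriteOps-nonempty record { lhs = _ ∷ _ } = s≤s z≤n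
  rewriteOps-nonempty record { lhs = [] ; lhs-has-nonterminal = () }

  local-applyRun : ∀ p {ℓ} ℓ≤ → length (ops p) ≤ ℓ → 1 ≤ ℓ → ∀ {w} → Local w →
                   Local (applyRun p ℓ ℓ≤ ++ w)
  local-applyRun p {suc ℓ} ℓ≤ ops≤ _ loc =
    opens-apply (toℕ-inject≤ zero ℓ≤) , tabulate-linked (λ i → apply p (inject≤ i ℓ≤)) links last loc
    where
    links : ∀ (i : Fin ℓ) → apply p (inject≤ (inject₁ i) ℓ≤) ⇢ apply p (inject≤ (suc i) ℓ≤)
    links i = inj₁ (continues (trans (toℕ-inject≤ (suc i) ℓ≤)
                (cong suc (sym (trans (toℕ-inject≤ (inject₁ i) ℓ≤) (toℕ-inject₁ i))))))
    last : ∀ {b} → Opens b → apply p (inject≤ (fromℕ ℓ) ℓ≤) ⇢ b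
    last opens = inj₂ (subst (λ i → length (ops p) ≤ suc i)
                   (sym (trans (toℕ-inject≤ (fromℕ ℓ) ℓ≤) (toℕ-fromℕ ℓ))) ops≤ , opens)

  local-applyWord : ∀ p {w} → Local w → Local (applyWord p ++ w)
  local-applyWord p = local-applyRun p (ops≤width p) ℕ.≤-refl (rewriteOps-nonempty (production p))

  exec-map-++ : ∀ {ιs ιs' c c' c''} → Exec (map op ιs) c c' → Exec (map op ιs') c' c'' →
                Exec (map op (ιs ++ ιs')) c c''
  exec-map-++ {ιs} {ιs'} ex ex' = subst (λ os → Exec os _ _) (sym (map-++ op ιs ιs')) (exec-++ ex ex')

  block : Fin NP → List Symbol → List Instr
  block p u = moveRight u ++ applyWord p ++ moveLeft (reverse u)

  exec-block : ∀ p u v → let pr = production p in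
    Exec (map op (block p u)) (just [] , just (u ++ lhs pr ++ v)) (just [] , just (u ++ rhs pr ++ v))
  exec-block p u v = exec-map-++ (exec-moveRight u) (exec-map-++ rewriting
    (subst (λ u' → Exec (map op (moveLeft (reverse u))) (just (reverse u ++ []) , just (rhs (production p) ++ v))
                         (just [] , just (u' ++ rhs (production p) ++ v))) (reverse-involutive u)
      (exec-moveLeft (reverse u))))
    where
    rewriting : Exec (map op (applyWord p)) (just (reverse u ++ []) , just (lhs (production p) ++ v))
                                            (just (reverse u ++ []) , just (rhs (production p) ++ v))
    rewriting = subst (λ os → Exec os (just (reverse u ++ []) , just (lhs (production p) ++ v))
                                      (just (reverse u ++ []) , just (rhs (production p) ++ v)))
                      (sym (map-op-applyWord p)) (exec-rewrite (production p))

  local-block : ∀ p u {w} → Local w → Local (block p u ++ w)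
  local-block p u {w} loc = subst Local (sym (++-assoc (moveRight u) _ w))
    (local-moveRight u (subst Local (sym (++-assoc (applyWord p) _ w))
      (local-applyWord p (local-moveLeft (reverse u) loc))))

  outputs-block : ∀ p u → outputs (block p u) ≡ []
  outputs-block p u = begin
    outputs (block p u)                          ≡⟨ concatMap-++ output (moveRight u) _ ⟩
    outputs (moveRight u) ++ outputs (applyWord p ++ moveLeft (reverse u))
      ≡⟨ cong₂ _++_ (outputs-moveRight u) (concatMap-++ output (applyWord p) _) ⟩
    outputs (applyWord p) ++ outputs (moveLeft (reverse u))
      ≡⟨ cong₂ _++_ (outputs-applies p (λ i → inject≤ i (ops≤width p))) (outputs-moveLeft (reverse u)) ⟩
    []                                           ∎
    where open ≡-Reasoning

  emitWord : Word k → List Instr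
  emitWord w = shut left ∷ map emit w ++ shut right ∷ []

  exec-emitWord : ∀ w → Exec (map op (emitWord w)) (just [] , just (map inj₁ w)) closed
  exec-emitWord w = on-left close-step ∷ exec-emits w
    where
    exec-emits : ∀ w → Exec (map op (map emit w ++ shut right ∷ [])) (nothing , just (map inj₁ w)) closed
    exec-emits []      = on-right close-step ∷ []
    exec-emits (_ ∷ w) = on-right pop-step ∷ exec-emits w

  local-emitWord : ∀ w → Local (emitWord w)
  local-emitWord w = opens-shut , linked-emits id w
    where
    linked-emits : ∀ {a} → (∀ {b} → Emits b → a ⇢ b) → ∀ w → Linked a (map emit w ++ shut right ∷ [])
    linked-emits link []      = link emits-shut , final
    linked-emits link (_ ∷ w) = link emits-emit , linked-emits id w

  outputs-emitWord : ∀ w → outputs (emitWord w) ≡ w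
  outputs-emitWord w = outputs-emits w
    where
    outputs-emits : ∀ w → outputs (map emit w ++ shut right ∷ []) ≡ w
    outputs-emits []      = refl
    outputs-emits (x ∷ w) = cong (x ∷_) (outputs-emits w)

  Program : List Symbol → Word k → Set
  Program α w = Σ (List Instr) λ ιs →
    Local ιs × Exec (map op ιs) (just [] , just α) closed × outputs ιs ≡ w

  derivation⇒program : ∀ {α} w → α ⇒* map inj₁ w → Program α w
  derivation⇒program w d-refl = emitWord w , local-emitWord w , exec-emitWord w , outputs-emitWord w
  derivation⇒program w (d-step (dstep u v pr pr∈) d) with ιs , loc , ex , out ← derivation⇒program w d =
    block (index pr∈) u ++ ιs , local-block (index pr∈) u loc , exec-map-++ rewrite-pr ex ,
    trans (concatMap-++ output (block (index pr∈) u) ιs) (cong₂ _++_ (outputs-block (index pr∈) u) out)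
    where
    rewrite-pr : Exec (map op (block (index pr∈) u)) (just [] , just (u ++ lhs pr ++ v))
                                                     (just [] , just (u ++ rhs pr ++ v))
    rewrite-pr = subst (λ q → Exec (map op (block (index pr∈) u)) (just [] , just (u ++ lhs q ++ v))
                                                                   (just [] , just (u ++ rhs q ++ v)))
                       (sym (lookup-index pr∈)) (exec-block (index pr∈) u v)

  open TwoStackNet code code-injective (op ∘ decode) public
  open OpenTree (encode ∘ edge) (λ s → cong op (decode-encode (edge s)))
               (λ s → encode ∘ put s) (λ s y → cong op (decode-encode (put s y))) public

  initial : State net
  initial = just (openTree [] axiom)

  finals : List (State net)
  finals = just finalTree ∷ []

  erase : Fin nInstr → Word k
  erase = output ∘ decode

  decode-encode-map : ∀ ιs → map decode (map encode ιs) ≡ ιs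
  decode-encode-map ιs = trans (sym (map-∘ ιs)) (trans (map-cong decode-encode ιs) (map-id ιs))

  hom-erase : ∀ w' → hom erase w' ≡ outputs (map decode w')
  hom-erase w' = sym (concatMap-map output decode w')

  initial-covers⇔exec : ∀ w' →
    CovLang net initial finals w' ⇔ Exec (map op (map decode w')) (just [] , just axiom) closed
  initial-covers⇔exec w' =
    subst (λ os → CovLang net initial finals w' ⇔ Exec os (just [] , just axiom) closed) (map-∘ w')
          (covers⇔exec (openTree-rep [] axiom) w')

  InImage : Word k → Set
  InImage w = Σ (Word nInstr) λ w' → (CovLang net initial finals w' × Local (map decode w')) × hom erase w' ≡ w

  simulation : ∀ w → GLang G w ⇔ InImage w
  simulation w = mk⇔ to from
    where
    to : axiom ⇒* map inj₁ w → InImage w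
    to d with ιs , loc , ex , out ← derivation⇒program w d =
      map encode ιs ,
      (Equivalence.from (initial-covers⇔exec _) (subst (λ ιs' → Exec (map op ιs') _ _) (sym decoded) ex) ,
       subst Local (sym decoded) loc) ,
      trans (hom-erase (map encode ιs)) (trans (cong outputs decoded) out)
      where
      decoded : map decode (map encode ιs) ≡ ιs
      decoded = decode-encode-map ιs
    from : InImage w → axiom ⇒* map inj₁ w
    from (w' , (cov , loc) , erased) = subst (λ u → axiom ⇒* map inj₁ u) (trans (sym (hom-erase w')) erased)
      (local⇒derivation (map decode w') loc (Equivalence.to (initial-covers⇔exec w') cov))

theorem2 : (k : ℕ) (L : Lang k) → IsRE L →
    Σ ℕ λ k' → Σ (LRPN k') λ N → Σ (State N) λ s₀ → Σ (List (State N)) λ Sf →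
    Σ (Lang k') λ R → IsRegular R × Σ (Fin k' → Word k) λ h →
    ∀ w → (L w → Σ (Word k') λ w' → (CovLang N s₀ Sf w' × R w') × hom h w' ≡ w)
        × (Σ (Word k') (λ w' → (CovLang N s₀ Sf w' × R w') × hom h w' ≡ w) → L w)
theorem2 k L (G , L⇔G) =
  nInstr , net , initial , finals , Local ∘ map decode , local-regular decode opens? follows? final? , erase ,
  λ w → Equivalence.to (simulation w) ∘ proj₁ (L⇔G w) , proj₂ (L⇔G w) ∘ Equivalence.from (simulation w)
  where open GrammarSimulation G
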